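{- Let $n > d \geq 3$. Suppose that $\mathcal{F}$ is a family of $2$-element subsets of $[n]=\{1,\ldots,n\}$ such that every $(d,\frac{d+1}{2})$-cluster is intersecting, i.e., for any $A_1,\ldots,A_d\in\mathcal{F}$, $|A_1\cup\cdots\cup A_d|\leq d+1$ implies $A_1\cap\cdots\cap A_d\neq\emptyset$. Then $|\mathcal{F}|\leq n-1$, with equality only when $\mathcal{F}$ is a complete star.
   Context: A family $\mathcal{F}$ of $2$-subsets of $[n]$ is a complete star if there is $x\in[n]$ such that $\mathcal{F}$ consists of all $2$-subsets of $[n]$ containing $x$. -}

module Defs where

open import Data.Nat using (ℕ; _≤_; _+_)
open import Data.Fin using (Fin)
open import Data.Fin.Subset using (Subset; ∣_∣; ⋃; ⋂; Nonempty) renaming (_∈_ to _∈ₛ_)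
open import Data.List using (List; tabulate)
open import Data.List.Membership.Propositional using (_∈_)
open import Data.List.Relation.Unary.All using (All)
open import Data.List.Relation.Unary.Unique.Propositional using (Unique)
open import Data.Product using (_×_; ∃)
open import Relation.Binary.PropositionalEquality using (_≡_; _≢_)
open import Function.Bundles using (_⇔_)

record TwoFamily (n : ℕ) : Set where
  field
    members : List (Subset n)
    unique  : Unique members
    two     : All (λ A → ∣ A ∣ ≡ 2) members
open TwoFamily public

ClustersIntersecting : ∀ {n} (d : ℕ) → TwoFamily n → Set
ClustersIntersecting {n} d F =
  (A : Fin d → Subset n) →
  (∀ i → A i ∈ members F) →
  (∀ i j → i ≢ j → A i ≢ A j) →
  ∣ ⋃ (tabulate A) ∣ ≤ d + 1 →
  Nonempty (⋂ (tabulate A))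

CompleteStar : ∀ {n} → TwoFamily n → Set
CompleteStar {n} F =
  ∃ λ (x : Fin n) → ∀ (A : Subset n) → (A ∈ members F) ⇔ ((∣ A ∣ ≡ 2) × (x ∈ₛ A))

-- Call a family of pairs E dense on a vertex list W if |W| ≤ |E| + 1. A dense family with
-- at least d edges all of whose (d, (d+1)/2)-clusters intersect is a star, by induction on |W|.
-- If |W| ≤ d + 1, any d edges form a cluster, so the first d edges share a vertex x.
-- Otherwise, as the degrees sum to at most 2|E|, some vertex v has degree at most |E| + 2 - |W|,
-- so the edges avoiding v are dense on W ∖ v and form a star at some x by induction.
-- In both cases the star T at x has at least d - 1 edges and is dense, so it covers every
-- vertex y ≠ x. An edge g ∌ x through y would then form, with the edge {x, y} of T and d - 2
-- further edges of T (here d ≥ 3 is used), a cluster on at most d + 1 vertices with no common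
-- vertex. Finally, a star at x on [n] has at most n - 1 edges, and exactly n - 1 only if it
-- contains every pair through x.

module Submission where

open import Defs
open import Data.Nat using (ℕ; suc; _+_; _*_; _∸_; _≤_; _<_; s≤s; z≤n; _≤?_)
open import Data.Nat.Properties
open import Data.Nat.Induction using (<-wellFounded)
open import Data.Nat.ListAction using (sum)
open import Data.Nat.Solver using (module +-*-Solver)
open import Algebra.Properties.CommutativeSemigroup +-commutativeSemigroup using (interchange)
open import Data.Bool.Properties using () renaming (_≟_ to _≟ᴮ_)
open import Data.Fin using (Fin) renaming (_≟_ to _≟ᶠ_)
open import Data.Fin.Properties using () renaming (any? to anyᶠ?)
open import Data.Fin.Subset using (Subset; ∣_∣; ⋃; ⋂; _∪_; ⁅_⁆; inside; outside)
  renaming (_∈_ to _∈ₛ_; _∉_ to _∉ₛ_; _⊆_ to _⊆ₛ_)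
open import Data.Fin.Subset.Properties
  using (_∈?_; ∉⊥; ∣⊥∣≡0; ∣⁅x⁆∣≡1; x∈⁅x⁆; x∈⁅y⁆⇒x≡y; x∈p∪q⁺; x∈p∪q⁻; x∈p∩q⁻; x∈p∧x≢y⇒x∈p-y;
         x∈p⇒∣p-x∣<∣p∣; p⊆q⇒∣p∣≤∣q∣; ⊆-antisym; ∪-identityʳ)
open import Data.Vec using ([]; _∷_)
open import Data.Vec.Properties using (≡-dec)
open import Data.List as List using (List; []; _∷_; length; map; lookup; allFin)
open import Data.List.Properties using (filter-notAll; filter-all; length-map; length-take; length-tabulate; tabulate-lookup)
open import Data.List.Membership.Propositional using (_∈_; find; lose)
open import Data.List.Membership.Propositional.Properties using (∈-filter⁺; ∈-filter⁻; ∈-map⁺; ∈-allFin; ∈-lookup)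
open import Data.List.Relation.Binary.Subset.Propositional using () renaming (_⊆_ to _⊆ₗ_)
open import Data.List.Relation.Binary.Subset.Propositional.Properties using (filter-⊆)
import Data.List.Relation.Binary.Sublist.Propositional as Sublist
open import Data.List.Relation.Binary.Sublist.Propositional.Properties using (take-⊆)
open import Data.List.Relation.Unary.Any as Any using (Any; here; there; any?)
open import Data.List.Relation.Unary.All as All using (All; []; _∷_)
import Data.List.Relation.Unary.All.Properties as All
open import Data.List.Relation.Unary.AllPairs using ([]; _∷_)
open import Data.List.Relation.Unary.Unique.Propositional using (Unique)
import Data.List.Relation.Unary.Unique.Propositional.Properties as Unique
open import Data.Product using (∃-syntax; _×_; _,_; proj₂)
open import Data.Sum using (inj₁; inj₂)
open import Data.Empty using (⊥; ⊥-elim)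
open import Function using (_∘_; mk⇔)
open import Induction.WellFounded using (Acc; acc)
open import Relation.Binary.Definitions using (DecidableEquality)
open import Relation.Binary.PropositionalEquality using (_≡_; _≢_; refl; sym; trans; cong; subst)
open import Relation.Nullary using (¬_; yes; no; contradiction)
open import Relation.Nullary.Decidable using (¬?; _×-dec_)
open import Relation.Unary using (Pred; Decidable)
open import Level using (0ℓ)

private variable
  n d : ℕ
  x y z : Fin n
  p e f g h : Subset n
  R S W : List _
  F T : TwoFamily n

module Removal {A : Set} (_≟_ : DecidableEquality A) where

  _∖_ : List A → A → List A
  xs ∖ a = List.filter (λ b → ¬? (b ≟ a)) xs

  ∈-∖⁺ : ∀ {a b xs} → b ∈ xs → b ≢ a → b ∈ xs ∖ a
  ∈-∖⁺ = ∈-filter⁺ (λ b → ¬? (b ≟ _))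

  length-∖< : ∀ {a xs} → a ∈ xs → length (xs ∖ a) < length xs
  length-∖< a∈xs = filter-notAll _ _ (Any.map (λ a≡b b≢a → b≢a (sym a≡b)) a∈xs)

  length≤1+length-∖ : ∀ {a xs} → Unique xs → length xs ≤ suc (length (xs ∖ a))
  length≤1+length-∖ {a} {[]} _ = z≤n
  length≤1+length-∖ {a} {b ∷ xs} (b∉xs ∷ uxs) with b ≟ a
  ... | yes refl = s≤s (≤-reflexive (sym (cong length (filter-all _ (All.map (_∘ sym) b∉xs)))))
  ... | no _ = s≤s (length≤1+length-∖ uxs)

  Unique-⊆⇒length≤ : ∀ {xs ys} → Unique xs → xs ⊆ₗ ys → length xs ≤ length ys
  Unique-⊆⇒length≤ {[]} _ _ = z≤n
  Unique-⊆⇒length≤ {a ∷ xs} {ys} (a∉xs ∷ uxs) a∷xs⊆ys =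
    ≤-trans (s≤s (Unique-⊆⇒length≤ uxs xs⊆ys∖a)) (length-∖< (a∷xs⊆ys (here refl)))
    where
    xs⊆ys∖a : xs ⊆ₗ ys ∖ a
    xs⊆ys∖a b∈xs = ∈-∖⁺ (a∷xs⊆ys (there b∈xs)) (All.lookup a∉xs b∈xs ∘ sym)

  choose : ∀ m {a xs} → a ∈ xs → Unique xs → suc m ≤ length xs →
           ∃[ ys ] length ys ≡ m × Unique (a ∷ ys) × (a ∷ ys) ⊆ₗ xs
  choose m {a} {xs} a∈xs uxs m<|xs| = ys , |ys|≡m , All.tabulate a≢ ∷ uys , a∷ys⊆xs
    where
    ys = List.take m (xs ∖ a)
    ys⊆xs∖a : ys ⊆ₗ xs ∖ a
    ys⊆xs∖a = Sublist.lookup (take-⊆ m (xs ∖ a))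
    |ys|≡m : length ys ≡ m
    |ys|≡m = trans (length-take m _) (m≤n⇒m⊓n≡m (≤-pred (≤-trans m<|xs| (length≤1+length-∖ uxs))))
    uys : Unique ys
    uys = Unique.take⁺ m (Unique.filter⁺ _ uxs)
    a≢ : ∀ {b} → b ∈ ys → a ≢ b
    a≢ b∈ys a≡b = let _ , b≢a = ∈-filter⁻ (λ b → ¬? (b ≟ a)) {xs = xs} (ys⊆xs∖a b∈ys) in b≢a (sym a≡b)
    a∷ys⊆xs : (a ∷ ys) ⊆ₗ xs
    a∷ys⊆xs (here refl) = a∈xs
    a∷ys⊆xs (there b∈ys) = filter-⊆ _ xs (ys⊆xs∖a b∈ys)

_≟ˢ_ : DecidableEquality (Subset n)
_≟ˢ_ = ≡-dec _≟ᴮ_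

open module FinRemoval {n} = Removal (_≟ᶠ_ {n}) using (_∖_; ∈-∖⁺; length-∖<)
open module SubsetRemoval {n} = Removal (_≟ˢ_ {n}) using (Unique-⊆⇒length≤; choose)

∣p∪q∣≤∣p∣+∣q∣ : (p q : Subset n) → ∣ p ∪ q ∣ ≤ ∣ p ∣ + ∣ q ∣
∣p∪q∣≤∣p∣+∣q∣ []            []            = z≤n
∣p∪q∣≤∣p∣+∣q∣ (inside ∷ p)  (inside ∷ q)  = s≤s (≤-trans (∣p∪q∣≤∣p∣+∣q∣ p q) (+-monoʳ-≤ ∣ p ∣ (n≤1+n ∣ q ∣)))
∣p∪q∣≤∣p∣+∣q∣ (inside ∷ p)  (outside ∷ q) = s≤s (∣p∪q∣≤∣p∣+∣q∣ p q)
∣p∪q∣≤∣p∣+∣q∣ (outside ∷ p) (inside ∷ q)  = ≤-trans (s≤s (∣p∪q∣≤∣p∣+∣q∣ p q)) (≤-reflexive (sym (+-suc ∣ p ∣ ∣ q ∣)))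
∣p∪q∣≤∣p∣+∣q∣ (outside ∷ p) (outside ∷ q) = ∣p∪q∣≤∣p∣+∣q∣ p q

∣⋃⁅⁆∣≤length : (xs : List (Fin n)) → ∣ ⋃ (map ⁅_⁆ xs) ∣ ≤ length xs
∣⋃⁅⁆∣≤length {n} []       = ≤-reflexive (∣⊥∣≡0 n)
∣⋃⁅⁆∣≤length (x ∷ xs) = begin
  ∣ ⁅ x ⁆ ∪ ⋃ (map ⁅_⁆ xs) ∣     ≤⟨ ∣p∪q∣≤∣p∣+∣q∣ ⁅ x ⁆ _ ⟩
  ∣ ⁅ x ⁆ ∣ + ∣ ⋃ (map ⁅_⁆ xs) ∣ ≡⟨ cong (_+ _) (∣⁅x⁆∣≡1 x) ⟩
  suc ∣ ⋃ (map ⁅_⁆ xs) ∣         ≤⟨ s≤s (∣⋃⁅⁆∣≤length xs) ⟩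
  suc (length xs)               ∎
  where open ≤-Reasoning

∈⋃⁅⁆ : {xs : List (Fin n)} → x ∈ xs → x ∈ₛ ⋃ (map ⁅_⁆ xs)
∈⋃⁅⁆ (here refl) = x∈p∪q⁺ (inj₁ (x∈⁅x⁆ _))
∈⋃⁅⁆ (there x∈xs) = x∈p∪q⁺ (inj₂ (∈⋃⁅⁆ x∈xs))

∣p∣≤length : (xs : List (Fin n)) → (∀ {x} → x ∈ₛ p → x ∈ xs) → ∣ p ∣ ≤ length xs
∣p∣≤length xs p⊆xs = ≤-trans (p⊆q⇒∣p∣≤∣q∣ (∈⋃⁅⁆ ∘ p⊆xs)) (∣⋃⁅⁆∣≤length xs)

Unique⇒length≤∣p∣ : {xs : List (Fin n)} → Unique xs → All (_∈ₛ p) xs → length xs ≤ ∣ p ∣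
Unique⇒length≤∣p∣ [] [] = z≤n
Unique⇒length≤∣p∣ (x∉xs ∷ uxs) (x∈p ∷ xs⊆p) =
  ≤-trans (s≤s (Unique⇒length≤∣p∣ uxs (All.zipWith (λ (z∈p , x≢z) → x∈p∧x≢y⇒x∈p-y z∈p (x≢z ∘ sym)) (xs⊆p , x∉xs))))
          (x∈p⇒∣p-x∣<∣p∣ x∈p)

pair-avoiding : ∣ e ∣ ≡ 2 → (a : Fin n) → ∃[ y ] y ∈ₛ e × y ≢ a
pair-avoiding {e = e} ∣e∣≡2 a with anyᶠ? (λ y → (y ∈? e) ×-dec ¬? (y ≟ᶠ a))
... | yes found = found
... | no none = contradiction (∣p∣≤length (a ∷ []) e⊆a) (subst (¬_ ∘ (_≤ 1)) (sym ∣e∣≡2) λ { (s≤s ()) })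
  where
  e⊆a : ∀ {y} → y ∈ₛ e → y ∈ a ∷ []
  e⊆a {y} y∈e with y ≟ᶠ a
  ... | yes y≡a = here y≡a
  ... | no y≢a = ⊥-elim (none (y , y∈e , y≢a))

pair≡⁅x⁆∪⁅y⁆ : ∣ e ∣ ≡ 2 → x ∈ₛ e → y ∈ₛ e → x ≢ y → e ≡ ⁅ x ⁆ ∪ ⁅ y ⁆
pair≡⁅x⁆∪⁅y⁆ {e = e} {x} {y} ∣e∣≡2 x∈e y∈e x≢y = ⊆-antisym e⊆ ⊆e
  where
  e⊆ : e ⊆ₛ ⁅ x ⁆ ∪ ⁅ y ⁆
  e⊆ {z} z∈e with z ≟ᶠ x | z ≟ᶠ y
  ... | yes refl | _        = x∈p∪q⁺ (inj₁ (x∈⁅x⁆ z))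
  ... | no _     | yes refl = x∈p∪q⁺ (inj₂ (x∈⁅x⁆ z))
  ... | no z≢x   | no z≢y   = contradiction three≤∣e∣ (subst (¬_ ∘ (3 ≤_)) (sym ∣e∣≡2) λ { (s≤s (s≤s ())) })
    where
    three≤∣e∣ : 3 ≤ ∣ e ∣
    three≤∣e∣ = Unique⇒length≤∣p∣ ((x≢y ∷ (z≢x ∘ sym) ∷ []) ∷ ((z≢y ∘ sym) ∷ []) ∷ [] ∷ []) (x∈e ∷ y∈e ∷ z∈e ∷ [])
  ⊆e : ⁅ x ⁆ ∪ ⁅ y ⁆ ⊆ₛ e
  ⊆e z∈ with x∈p∪q⁻ ⁅ x ⁆ ⁅ y ⁆ z∈
  ... | inj₁ z∈⁅x⁆ = subst (_∈ₛ e) (sym (x∈⁅y⁆⇒x≡y x z∈⁅x⁆)) x∈e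
  ... | inj₂ z∈⁅y⁆ = subst (_∈ₛ e) (sym (x∈⁅y⁆⇒x≡y y z∈⁅y⁆)) y∈e

pair≡pair : ∣ e ∣ ≡ 2 → ∣ f ∣ ≡ 2 → x ≢ y → x ∈ₛ e → y ∈ₛ e → x ∈ₛ f → y ∈ₛ f → e ≡ f
pair≡pair ∣e∣≡2 ∣f∣≡2 x≢y x∈e y∈e x∈f y∈f =
  trans (pair≡⁅x⁆∪⁅y⁆ ∣e∣≡2 x∈e y∈e x≢y) (sym (pair≡⁅x⁆∪⁅y⁆ ∣f∣≡2 x∈f y∈f x≢y))

∣pair∪p∣≤1+∣p∣ : ∣ e ∣ ≡ 2 → x ∈ₛ e → x ∈ₛ p → ∣ e ∪ p ∣ ≤ suc ∣ p ∣
∣pair∪p∣≤1+∣p∣ {e = e} {x} {p} ∣e∣≡2 x∈e x∈p with y , y∈e , y≢x ← pair-avoiding ∣e∣≡2 x = begin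
  ∣ e ∪ p ∣         ≤⟨ p⊆q⇒∣p∣≤∣q∣ e∪p⊆ ⟩
  ∣ ⁅ y ⁆ ∪ p ∣     ≤⟨ ∣p∪q∣≤∣p∣+∣q∣ ⁅ y ⁆ p ⟩
  ∣ ⁅ y ⁆ ∣ + ∣ p ∣ ≡⟨ cong (_+ ∣ p ∣) (∣⁅x⁆∣≡1 y) ⟩
  suc ∣ p ∣         ∎
  where
  open ≤-Reasoning
  e∪p⊆ : e ∪ p ⊆ₛ ⁅ y ⁆ ∪ p
  e∪p⊆ z∈e∪p with x∈p∪q⁻ e p z∈e∪p
  ... | inj₂ z∈p = x∈p∪q⁺ (inj₂ z∈p)
  ... | inj₁ z∈e with x∈p∪q⁻ ⁅ x ⁆ ⁅ y ⁆ (subst (_ ∈ₛ_) (pair≡⁅x⁆∪⁅y⁆ ∣e∣≡2 x∈e y∈e (y≢x ∘ sym)) z∈e)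
  ...   | inj₁ z∈⁅x⁆ = x∈p∪q⁺ (inj₂ (subst (_∈ₛ p) (sym (x∈⁅y⁆⇒x≡y x z∈⁅x⁆)) x∈p))
  ...   | inj₂ z∈⁅y⁆ = x∈p∪q⁺ (inj₁ z∈⁅y⁆)

Pairs : List (Subset n) → Set
Pairs = All (λ e → ∣ e ∣ ≡ 2)

Star : Fin n → List (Subset n) → Set
Star x = All (x ∈ₛ_)

Within : List (Fin n) → List (Subset n) → Set
Within W = All (λ e → ∀ {z} → z ∈ₛ e → z ∈ W)

ClustersIntersectingₗ : ℕ → List (Subset n) → Set
ClustersIntersectingₗ d E =
  ∀ S → S ⊆ₗ E → Unique S → length S ≡ d → ∣ ⋃ S ∣ ≤ suc d → ∃[ z ] Star z S

module Family where

  filter : {P : Pred (Subset n) 0ℓ} → Decidable P → TwoFamily n → TwoFamily n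
  filter P? F = record
    { members = List.filter P? (members F)
    ; unique  = Unique.filter⁺ P? (unique F)
    ; two     = All.filter⁺ P? (two F)
    }

  take : ℕ → TwoFamily n → TwoFamily n
  take m F = record
    { members = List.take m (members F)
    ; unique  = Unique.take⁺ m (unique F)
    ; two     = All.take⁺ m (two F)
    }

lookup-injective : {A : Set} (xs : List A) → Unique xs → ∀ i j → lookup xs i ≡ lookup xs j → i ≡ j
lookup-injective (_ ∷ _)  _           Fin.zero    Fin.zero    _  = refl
lookup-injective (_ ∷ _)  (x∉ ∷ _)    Fin.zero    (Fin.suc j) eq = contradiction eq (All.lookup x∉ (∈-lookup j))
lookup-injective (_ ∷ _)  (x∉ ∷ _)    (Fin.suc i) Fin.zero    eq = contradiction (sym eq) (All.lookup x∉ (∈-lookup i))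
lookup-injective (_ ∷ xs) (_ ∷ uxs)   (Fin.suc i) (Fin.suc j) eq = cong Fin.suc (lookup-injective xs uxs i j eq)

∈⋂⇒Star : (S : List (Subset n)) → z ∈ₛ ⋂ S → Star z S
∈⋂⇒Star []      _     = []
∈⋂⇒Star (e ∷ S) z∈⋂S = let z∈e , z∈⋂ = x∈p∩q⁻ e (⋂ S) z∈⋂S in z∈e ∷ ∈⋂⇒Star S z∈⋂

clustersIntersectingₗ : ClustersIntersecting d F → ClustersIntersectingₗ d (members F)
clustersIntersectingₗ {d} ci S S⊆F uS refl ∣⋃S∣≤
  with z , z∈⋂ ← ci (lookup S) (S⊆F ∘ ∈-lookup) (λ i j i≢j → i≢j ∘ lookup-injective S uS i j)
                    (subst (λ L → ∣ ⋃ L ∣ ≤ length S + 1) (sym (tabulate-lookup S))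
                           (≤-trans ∣⋃S∣≤ (≤-reflexive (+-comm 1 _))))
  = z , ∈⋂⇒Star S (subst (λ L → z ∈ₛ ⋂ L) (tabulate-lookup S) z∈⋂)

∣⋃star∣≤ : Pairs (e ∷ S) → Star x (e ∷ S) → ∣ ⋃ (e ∷ S) ∣ ≤ 2 + length S
∣⋃star∣≤ {e = e} {S = []} (∣e∣≡2 ∷ []) _ =
  ≤-reflexive (trans (cong ∣_∣ (∪-identityʳ e)) ∣e∣≡2)
∣⋃star∣≤ {S = f ∷ S} (∣e∣≡2 ∷ pairs) (x∈e ∷ x∈f ∷ star) =
  ≤-trans (∣pair∪p∣≤1+∣p∣ ∣e∣≡2 x∈e (x∈p∪q⁺ (inj₁ x∈f))) (s≤s (∣⋃star∣≤ pairs (x∈f ∷ star)))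

∣⋃∣≤length : Within W S → ∣ ⋃ S ∣ ≤ length W
∣⋃∣≤length {W = W} {S = S} within = ∣p∣≤length W (λ z∈⋃S → ∈⋃ S within z∈⋃S)
  where
  ∈⋃ : ∀ S → Within W S → z ∈ₛ ⋃ S → z ∈ W
  ∈⋃ [] [] z∈⊥ = contradiction z∈⊥ ∉⊥
  ∈⋃ (e ∷ S) (e⊆W ∷ within) z∈⋃ with x∈p∪q⁻ e (⋃ S) z∈⋃
  ... | inj₁ z∈e = e⊆W z∈e
  ... | inj₂ z∈⋃S = ∈⋃ S within z∈⋃S

centre∈W : Star x S → Within W S → 0 < length S → x ∈ W
centre∈W (x∈e ∷ _) (e⊆W ∷ _) _ = e⊆W x∈e

star-length≤ : (F : TwoFamily n) → Star x (members F) → (V : List (Fin n)) →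
               (∀ {e} → e ∈ members F → ∀ {z} → z ∈ₛ e → z ≢ x → z ∈ V) → length (members F) ≤ length V
star-length≤ {x = x} F star V others = begin
  length (members F)          ≤⟨ Unique-⊆⇒length≤ (unique F) F⊆edges ⟩
  length (map edgeTo V)       ≡⟨ length-map edgeTo V ⟩
  length V                    ∎
  where
  open ≤-Reasoning
  edgeTo : Fin _ → Subset _
  edgeTo z = ⁅ x ⁆ ∪ ⁅ z ⁆
  F⊆edges : members F ⊆ₗ map edgeTo V
  F⊆edges e∈F with z , z∈e , z≢x ← pair-avoiding (All.lookup (two F) e∈F) x =
    subst (_∈ map edgeTo V) (sym (pair≡⁅x⁆∪⁅y⁆ (All.lookup (two F) e∈F) (All.lookup star e∈F) z∈e (z≢x ∘ sym)))
          (∈-map⁺ edgeTo (others e∈F z∈e z≢x))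

star-length+2≤ : Star x (members T) → Within W (members T) → x ∈ W → y ∈ W → y ≢ x →
                 ¬ Any (y ∈ₛ_) (members T) → 2 + length (members T) ≤ length W
star-length+2≤ {x = x} {T = T} {W = W} {y = y} star within x∈W y∈W y≢x y-uncovered = begin
  2 + length (members T)   ≤⟨ s≤s (s≤s (star-length≤ T star ((W ∖ y) ∖ x) others)) ⟩
  2 + length ((W ∖ y) ∖ x) ≤⟨ s≤s (length-∖< (∈-∖⁺ x∈W (y≢x ∘ sym))) ⟩
  1 + length (W ∖ y)       ≤⟨ length-∖< y∈W ⟩
  length W                 ∎
  where
  open ≤-Reasoning
  others : ∀ {e} → e ∈ members T → ∀ {z} → z ∈ₛ e → z ≢ x → z ∈ (W ∖ y) ∖ x
  others e∈T {z} z∈e z≢x = ∈-∖⁺ (∈-∖⁺ (All.lookup within e∈T z∈e) λ { refl → y-uncovered (lose e∈T z∈e) }) z≢x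

-- g adds only one vertex to the star h, f, R, so the cluster spans at most d + 1 vertices;
-- a common vertex would differ from x ∉ g, and h, f cannot share two vertices.
off-centre-cluster : ClustersIntersectingₗ (3 + length R) (members F) → (g ∷ h ∷ f ∷ R) ⊆ₗ members F →
                     Unique (h ∷ f ∷ R) → Star x (h ∷ f ∷ R) → x ∉ₛ g → y ∈ₛ g → y ∈ₛ h → ⊥
off-centre-cluster {R = R} {F = F} {g = g} {h = h} {f = f} {x = x}
                   clusters cluster⊆F u@((h≢f ∷ _) ∷ _) star@(x∈h ∷ x∈f ∷ _) x∉g y∈g y∈h
  = no-common-vertex (clusters cluster cluster⊆F (All.map g≢ star ∷ u) refl ∣⋃cluster∣≤)
  where
  cluster = g ∷ h ∷ f ∷ R
  pairs : Pairs cluster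
  pairs = All.anti-mono cluster⊆F (two F)
  ∣h∣≡2 = All.lookup pairs (there (here refl))
  ∣f∣≡2 = All.lookup pairs (there (there (here refl)))
  g≢ : ∀ {e} → x ∈ₛ e → g ≢ e
  g≢ x∈e refl = x∉g x∈e
  ∣⋃cluster∣≤ : ∣ ⋃ cluster ∣ ≤ 4 + length R
  ∣⋃cluster∣≤ = ≤-trans (∣pair∪p∣≤1+∣p∣ (All.head pairs) y∈g (x∈p∪q⁺ (inj₁ y∈h))) (s≤s (∣⋃star∣≤ (All.tail pairs) star))
  no-common-vertex : ∃[ z ] Star z cluster → ⊥
  no-common-vertex (z , z∈g ∷ z∈h ∷ z∈f ∷ _) = h≢f (pair≡pair ∣h∣≡2 ∣f∣≡2 (λ { refl → x∉g z∈g }) x∈h z∈h x∈f z∈f)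

meets-star⇒centre∈ : 3 ≤ d → ClustersIntersectingₗ d (members F) → members T ⊆ₗ members F → Star x (members T) →
                     d ≤ suc (length (members T)) → g ∈ members F → h ∈ members T → y ∈ₛ g → y ∈ₛ h → x ∈ₛ g
meets-star⇒centre∈ {d = suc (suc (suc k))} {F = F} {T = T} {x = x} {g = g} {h = h}
                   (s≤s (s≤s (s≤s _))) clusters T⊆F star large g∈F h∈T y∈g y∈h with x ∈? g
... | yes x∈g = x∈g
... | no x∉g with choose (suc k) h∈T (unique T) (≤-pred large)
...   | f ∷ R , refl , u , h∷f∷R⊆T =
  ⊥-elim (off-centre-cluster {F = F} clusters cluster⊆F u (All.anti-mono h∷f∷R⊆T star) x∉g y∈g y∈h)
  where
  cluster⊆F : (g ∷ h ∷ f ∷ R) ⊆ₗ members F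
  cluster⊆F (here refl) = g∈F
  cluster⊆F (there e∈) = T⊆F (h∷f∷R⊆T e∈)

dense-star-absorbs : 3 ≤ d → ClustersIntersectingₗ d (members F) → members T ⊆ₗ members F → Star x (members T) →
                     Within W (members T) → d ≤ suc (length (members T)) → length W ≤ suc (length (members T)) →
                     g ∈ members F → y ∈ₛ g → y ∈ W → x ∈ₛ g
dense-star-absorbs {F = F} {T = T} {x = x} {y = y} 3≤d clusters T⊆F star within large dense g∈F y∈g y∈W
  with y ≟ᶠ x
... | yes refl = y∈g
... | no y≢x with any? (y ∈?_) (members T)
...   | yes y-covered with h , h∈T , y∈h ← find y-covered =
  meets-star⇒centre∈ {F = F} {T = T} 3≤d clusters T⊆F star large g∈F h∈T y∈g y∈h
...   | no y-uncovered = contradiction dense (<⇒≱ (star-length+2≤ {T = T} star within x∈W y∈W y≢x y-uncovered))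
  where
  x∈W = centre∈W star within (≤-trans (s≤s z≤n) (≤-pred (≤-trans 3≤d large)))

incidence : Subset n → Fin n → ℕ
incidence e w with w ∈? e
... | yes _ = 1
... | no  _ = 0

degree : List (Subset n) → Fin n → ℕ
degree []      w = 0
degree (e ∷ E) w = incidence e w + degree E w

avoiding : Fin n → TwoFamily n → TwoFamily n
avoiding v = Family.filter (λ e → ¬? (v ∈? e))

degree+length-avoiding : (v : Fin n) (E : List (Subset n)) →
                         degree E v + length (List.filter (λ e → ¬? (v ∈? e)) E) ≡ length E
degree+length-avoiding v []      = refl
degree+length-avoiding v (e ∷ E) with v ∈? e
... | yes _ = cong suc (degree+length-avoiding v E)
... | no  _ = trans (+-suc _ _) (cong suc (degree+length-avoiding v E))

sum-map-+ : {A : Set} (f g : A → ℕ) (xs : List A) →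
            sum (map (λ a → f a + g a) xs) ≡ sum (map f xs) + sum (map g xs)
sum-map-+ f g []       = refl
sum-map-+ f g (a ∷ xs) = trans (cong (f a + g a +_) (sum-map-+ f g xs)) (interchange (f a) (g a) _ _)

sum-map-const : {A : Set} (k : ℕ) (xs : List A) → sum (map (λ _ → k) xs) ≡ length xs * k
sum-map-const k []       = refl
sum-map-const k (_ ∷ xs) = cong (k +_) (sum-map-const k xs)

All≤⇒length*≤sum : {A : Set} {c : ℕ} (f : A → ℕ) {xs : List A} → All (λ a → c ≤ f a) xs → length xs * c ≤ sum (map f xs)
All≤⇒length*≤sum f []         = z≤n
All≤⇒length*≤sum f (c≤ ∷ c≤s) = +-mono-≤ c≤ (All≤⇒length*≤sum f c≤s)

sum-incidence≡length-filter : (e : Subset n) (W : List (Fin n)) →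
                              sum (map (incidence e) W) ≡ length (List.filter (_∈? e) W)
sum-incidence≡length-filter e []      = refl
sum-incidence≡length-filter e (w ∷ W) with w ∈? e
... | yes _ = cong suc (sum-incidence≡length-filter e W)
... | no  _ = sum-incidence≡length-filter e W

sum-degree≤ : {W : List (Fin n)} (E : List (Subset n)) → Unique W → Pairs E → sum (map (degree E) W) ≤ 2 * length E
sum-degree≤ {W = W} []      _  []              = ≤-reflexive (trans (sum-map-const 0 W) (*-zeroʳ (length W)))
sum-degree≤ {W = W} (e ∷ E) uW (∣e∣≡2 ∷ pairs) = begin
  sum (map (degree (e ∷ E)) W)                        ≡⟨ sum-map-+ (incidence e) (degree E) W ⟩
  sum (map (incidence e) W) + sum (map (degree E) W)  ≤⟨ +-mono-≤ incidences≤2 (sum-degree≤ E uW pairs) ⟩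
  2 + 2 * length E                                    ≡⟨ sym (*-suc 2 (length E)) ⟩
  2 * length (e ∷ E)                                  ∎
  where
  open ≤-Reasoning
  incidences≤2 : sum (map (incidence e) W) ≤ 2
  incidences≤2 = begin
    sum (map (incidence e) W)        ≡⟨ sum-incidence≡length-filter e W ⟩
    length (List.filter (_∈? e) W)   ≤⟨ Unique⇒length≤∣p∣ (Unique.filter⁺ _ uW) (All.all-filter _ W) ⟩
    ∣ e ∣                            ≡⟨ ∣e∣≡2 ⟩
    2                                ∎

2e+m²<m[e+3] : ∀ {m e} → 2 ≤ m → m ≤ suc e → 2 * e + m * m < m * suc (e + 2)
2e+m²<m[e+3] {suc (suc a)} (s≤s (s≤s _)) (s≤s a+1≤e) with b , refl ← m≤n⇒∃[o]m+o≡n a+1≤e =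
  subst (2 * (suc a + b) + (2 + a) * (2 + a) <_) (identity a b) (m<m+n _ (s≤s z≤n))
  where
  open +-*-Solver
  identity : ∀ a b → 2 * (suc a + b) + (2 + a) * (2 + a) + (2 + a * b) ≡ (2 + a) * suc (suc a + b + 2)
  identity = solve 2 (λ a b → con 2 :* (con 1 :+ a :+ b) :+ (con 2 :+ a) :* (con 2 :+ a) :+ (con 2 :+ a :* b)
                           := (con 2 :+ a) :* (con 1 :+ (con 1 :+ a :+ b :+ con 2))) refl

low-degree-vertex : (E : List (Subset n)) → Unique W → Pairs E → 2 ≤ length W → length W ≤ suc (length E) →
                    ∃[ v ] v ∈ W × degree E v + length W ≤ length E + 2
low-degree-vertex {W = W} E uW pairs 2≤|W| dense with any? (λ v → degree E v + length W ≤? length E + 2) W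
... | yes found = find found
... | no none = contradiction degree-sum-large (<⇒≱ (2e+m²<m[e+3] 2≤|W| dense))
  where
  open ≤-Reasoning
  m = length W
  degree-sum-large : m * suc (length E + 2) ≤ 2 * length E + m * m
  degree-sum-large = begin
    m * suc (length E + 2)                         ≤⟨ All≤⇒length*≤sum _ (All.tabulate (λ v∈W → ≰⇒> (none ∘ lose v∈W))) ⟩
    sum (map (λ v → degree E v + m) W)             ≡⟨ sum-map-+ (degree E) (λ _ → m) W ⟩
    sum (map (degree E) W) + sum (map (λ _ → m) W) ≡⟨ cong (sum (map (degree E) W) +_) (sum-map-const m W) ⟩
    sum (map (degree E) W) + m * m                 ≤⟨ +-monoˡ-≤ (m * m) (sum-degree≤ {W = W} E uW pairs) ⟩
    2 * length E + m * m                           ∎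

within-avoiding : (v : Fin n) (F : TwoFamily n) → Within W (members F) → Within (W ∖ v) (members (avoiding v F))
within-avoiding v F within = All.tabulate λ e∈F' z∈e →
  ∈-∖⁺ (All.lookup within (filter-⊆ _ (members F) e∈F') z∈e)
       λ { refl → proj₂ (∈-filter⁻ (λ e → ¬? (v ∈? e)) {xs = members F} e∈F') z∈e }

length≤2+length-avoiding : (v : Fin n) (F : TwoFamily n) → degree (members F) v + length W ≤ length (members F) + 2 →
                           length W ≤ 2 + length (members (avoiding v F))
length≤2+length-avoiding {W = W} v F low = +-cancelˡ-≤ a (length W) (2 + e′) (begin
  a + length W           ≤⟨ low ⟩
  length (members F) + 2 ≡⟨ cong (_+ 2) (sym (degree+length-avoiding v (members F))) ⟩
  a + e′ + 2             ≡⟨ +-assoc a e′ 2 ⟩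
  a + (e′ + 2)           ≡⟨ cong (a +_) (+-comm e′ 2) ⟩
  a + (2 + e′)           ∎)
  where
  open ≤-Reasoning
  a = degree (members F) v
  e′ = length (members (avoiding v F))

small⇒star : 3 ≤ d → ClustersIntersectingₗ d (members F) → Within W (members F) → d ≤ length (members F) →
             length W ≤ suc d → ∃[ x ] Star x (members F)
small⇒star {d = d} {F = F} {W = W} 3≤d clusters within d≤|F| |W|≤1+d =
  absorb-all (clusters (members T₀) T⊆F (unique T₀) |T₀|≡d (≤-trans (∣⋃∣≤length withinT) |W|≤1+d))
  where
  T₀ = Family.take d F
  T⊆F : members T₀ ⊆ₗ members F
  T⊆F = Sublist.lookup (take-⊆ d (members F))
  withinT : Within W (members T₀)
  withinT = All.anti-mono T⊆F within
  |T₀|≡d : length (members T₀) ≡ d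
  |T₀|≡d = trans (length-take d _) (m≤n⇒m⊓n≡m d≤|F|)
  absorb-all : ∃[ x ] Star x (members T₀) → ∃[ x ] Star x (members F)
  absorb-all (x , star) = x , All.tabulate absorb
    where
    absorb : ∀ {g} → g ∈ members F → x ∈ₛ g
    absorb g∈F with y , y∈g , _ ← pair-avoiding (All.lookup (two F) g∈F) x =
      dense-star-absorbs {F = F} {T = T₀} 3≤d clusters T⊆F star withinT
        (≤-trans (n≤1+n d) (s≤s (≤-reflexive (sym |T₀|≡d)))) (subst (λ k → length W ≤ suc k) (sym |T₀|≡d) |W|≤1+d)
        g∈F y∈g (All.lookup within g∈F y∈g)

dense⇒star : 3 ≤ d → ClustersIntersectingₗ d (members F) → Unique W → Within W (members F) →
             d ≤ length (members F) → length W ≤ suc (length (members F)) → Acc _<_ (length W) →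
             ∃[ x ] Star x (members F)
dense⇒star {d = d} {F = F} {W = W} 3≤d clusters uW within d≤|F| dense (acc smaller) with length W ≤? suc d
... | yes |W|≤1+d = small⇒star {F = F} 3≤d clusters within d≤|F| |W|≤1+d
... | no  |W|≰1+d = step (low-degree-vertex (members F) uW (two F) (≤-trans (s≤s (s≤s z≤n)) (≰⇒> |W|≰1+d)) dense)
  where
  step : ∃[ v ] v ∈ W × degree (members F) v + length W ≤ length (members F) + 2 → ∃[ x ] Star x (members F)
  step (v , v∈W , low) =
    extend (dense⇒star {F = F'} 3≤d clusters' (Unique.filter⁺ _ uW) within' d≤|F'| dense' (smaller (length-∖< v∈W)))
    where
    F' = avoiding v F
    F'⊆F : members F' ⊆ₗ members F
    F'⊆F = filter-⊆ (λ e → ¬? (v ∈? e)) (members F)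
    clusters' : ClustersIntersectingₗ d (members F')
    clusters' S S⊆F' = clusters S (F'⊆F ∘ S⊆F')
    within' : Within (W ∖ v) (members F')
    within' = within-avoiding v F within
    |W|≤2+|F'| : length W ≤ 2 + length (members F')
    |W|≤2+|F'| = length≤2+length-avoiding {W = W} v F low
    d≤|F'| : d ≤ length (members F')
    d≤|F'| = ≤-pred (≤-pred (≤-trans (≰⇒> |W|≰1+d) |W|≤2+|F'|))
    dense' : length (W ∖ v) ≤ suc (length (members F'))
    dense' = ≤-pred (≤-trans (length-∖< v∈W) |W|≤2+|F'|)
    extend : ∃[ x ] Star x (members F') → ∃[ x ] Star x (members F)
    extend (x , star') = x , All.tabulate absorb
      where
      absorb : ∀ {g} → g ∈ members F → x ∈ₛ g
      absorb g∈F with y , y∈g , y≢v ← pair-avoiding (All.lookup (two F) g∈F) v =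
        dense-star-absorbs {F = F} {T = F'} 3≤d clusters F'⊆F star' within' (≤-trans (n≤1+n d) (s≤s d≤|F'|)) dense'
          g∈F y∈g (∈-∖⁺ (All.lookup within g∈F y∈g) y≢v)

length-allFin : length (allFin n) ≡ n
length-allFin = length-tabulate _

within-allFin : (E : List (Subset n)) → Within (allFin n) E
within-allFin E = All.tabulate λ _ {z} _ → ∈-allFin z

star-length≤n : (F : TwoFamily (suc n)) → Star x (members F) → length (members F) ≤ n
star-length≤n {n} {x} F star = ≤-pred (begin-strict
  length (members F)          ≤⟨ star-length≤ F star (allFin (suc n) ∖ x) (λ _ {z} _ z≢x → ∈-∖⁺ (∈-allFin z) z≢x) ⟩
  length (allFin (suc n) ∖ x) <⟨ length-∖< (∈-allFin x) ⟩
  length (allFin (suc n))     ≡⟨ length-allFin ⟩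
  suc n                       ∎)
  where open ≤-Reasoning

full-star-complete : (F : TwoFamily (suc n)) → Star x (members F) → n ≤ length (members F) →
                     ∣ e ∣ ≡ 2 → x ∈ₛ e → e ∈ members F
full-star-complete {n} {x} {e} F star n≤|F| ∣e∣≡2 x∈e with any? (e ≟ˢ_) (members F)
... | yes e∈F = e∈F
... | no  e∉F = ⊥-elim (missing-vertex (pair-avoiding ∣e∣≡2 x))
  where
  missing-vertex : ∃[ y ] y ∈ₛ e × y ≢ x → ⊥
  missing-vertex (y , y∈e , y≢x) =
    1+n≰n (≤-pred (≤-trans (s≤s (s≤s n≤|F|)) (≤-trans 2+|F|≤ (≤-reflexive length-allFin))))
    where
    uncovered : ¬ Any (y ∈ₛ_) (members F)
    uncovered y-covered with f , f∈F , y∈f ← find y-covered =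
      e∉F (subst (_∈ members F) (pair≡pair (All.lookup (two F) f∈F) ∣e∣≡2 (y≢x ∘ sym) (All.lookup star f∈F) y∈f x∈e y∈e) f∈F)
    2+|F|≤ : 2 + length (members F) ≤ length (allFin (suc n))
    2+|F|≤ = star-length+2≤ {T = F} star (within-allFin _) (∈-allFin x) (∈-allFin y) y≢x uncovered

lemma2p3 : (n d : ℕ) → 3 ≤ d → d < n → (F : TwoFamily n) → ClustersIntersecting d F →
    (length (members F) ≤ n ∸ 1) × (length (members F) ≡ n ∸ 1 → CompleteStar F)
lemma2p3 (suc n) d 3≤d (s≤s d≤n) F ci = |F|≤n , complete
  where
  large⇒star : n ≤ length (members F) → ∃[ x ] Star x (members F)
  large⇒star n≤|F| = dense⇒star {F = F} 3≤d (clustersIntersectingₗ {F = F} ci) (Unique.allFin⁺ (suc n)) (within-allFin _)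
    (≤-trans d≤n n≤|F|) (subst (_≤ suc (length (members F))) (sym length-allFin) (s≤s n≤|F|)) (<-wellFounded _)
  |F|≤n : length (members F) ≤ n
  |F|≤n with n ≤? length (members F)
  ... | yes n≤|F| = star-length≤n F (proj₂ (large⇒star n≤|F|))
  ... | no  n≰|F| = <⇒≤ (≰⇒> n≰|F|)
  complete : length (members F) ≡ n → CompleteStar F
  complete |F|≡n = let x , star = large⇒star (≤-reflexive (sym |F|≡n)) in
    x , λ e → mk⇔ (λ e∈F → All.lookup (two F) e∈F , All.lookup star e∈F)
                  (λ (∣e∣≡2 , x∈e) → full-star-complete F star (≤-reflexive (sym |F|≡n)) ∣e∣≡2 x∈e)
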